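{- On simply typed $\lambda$-terms, the rewriting systems $\to_a$, $\multimap$, $\to_{\beta_d}$, $\to_\beta$, $\to_h$ and $\multimap_h$ are strongly normalising (there is no infinite reduction sequence starting from a simply typed term).
   Context: Types: $\tau,\sigma::=o\mid\tau\to\sigma$; simply typed terms: variables have fixed types, $\lambda x^\tau.t^\sigma:\tau\to\sigma$, and $s^{\tau\to\sigma}t^\tau:\sigma$. Terms are modulo $\alpha$-conversion with the distinct names convention; $t\{s/x\}$ capture-avoiding substitution; $\mathsf{FV}$ free variables. Contexts have one hole $\square$, plugging without renaming. H-contexts: $H::=\square\mid\lambda x.H\mid H\,t$. E-contexts: $E::=\square\mid E_1[\lambda x.E_2]\,t$. A fresh copy $s'$ of $s$ is an $\alpha$-equivalent copy with all bound variables renamed to new names. Reductions: $\to_\beta$ is $(\lambda x.t)s\to t\{s/x\}$ closed under contexts; $\to_{\beta_d}$ is $E[\lambda x.t]s\to E[t\{s/x\}]$ closed under contexts; $\to_h$ is $\lambda y_1.\ldots\lambda y_k.(\lambda x.t)s\,u_1\ldots u_h\to\lambda y_1.\ldots\lambda y_k.t\{s/x\}u_1\ldots u_h$; $\multimap$ is $E[\lambda x.C[x]]s\multimap E[\lambda x.C[s']]s$ ($C$ a context whose hole is an occurrence of $x$ bound by the displayed $\lambda x$, $s'$ a fresh copy of $s$) closed under contexts; $\to_g$ is $E[\lambda x.t]s\to E[t]$ when $x\notin\mathsf{FV}(t)$, closed under contexts; $\to_a=\multimap\cup\to_g$; $\multimap_h$ is the rule $E[\lambda x.H[x]]s\multimap_h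 E[\lambda x.H[s']]s$ ($H$ an H-context with $x$ in its hole) closed under H-contexts. -}

module Defs where

open import Data.List using (List; []; _∷_)
open import Data.Nat using (ℕ; zero; suc)
open import Data.Product using (Σ; _×_)
open import Relation.Binary.PropositionalEquality using (_≡_)
open import Relation.Nullary using (¬_)

-- Terms up to α-conversion = de Bruijn terms; the "distinct names
-- convention" is realised by de Bruijn weakening (renaming).

infixr 7 _⇒_
data Ty : Set where
  o   : Ty
  _⇒_ : Ty → Ty → Ty

Ctx : Set
Ctx = List Ty

infix 4 _∋_
data _∋_ : Ctx → Ty → Set where
  Z : ∀ {Γ A} → (A ∷ Γ) ∋ A
  S : ∀ {Γ A B} → Γ ∋ A → (B ∷ Γ) ∋ A

data Tm (Γ : Ctx) : Ty → Set where
  var : ∀ {A} → Γ ∋ A → Tm Γ A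
  lam : ∀ {A B} → Tm (A ∷ Γ) B → Tm Γ (A ⇒ B)
  app : ∀ {A B} → Tm Γ (A ⇒ B) → Tm Γ A → Tm Γ B

Ren : Ctx → Ctx → Set
Ren Γ Δ = ∀ {A} → Γ ∋ A → Δ ∋ A

ext : ∀ {Γ Δ B} → Ren Γ Δ → Ren (B ∷ Γ) (B ∷ Δ)
ext ρ Z     = Z
ext ρ (S x) = S (ρ x)

rename : ∀ {Γ Δ A} → Ren Γ Δ → Tm Γ A → Tm Δ A
rename ρ (var x)   = var (ρ x)
rename ρ (lam t)   = lam (rename (ext ρ) t)
rename ρ (app t u) = app (rename ρ t) (rename ρ u)

Sub : Ctx → Ctx → Set
Sub Γ Δ = ∀ {A} → Γ ∋ A → Tm Δ A

exts : ∀ {Γ Δ B} → Sub Γ Δ → Sub (B ∷ Γ) (B ∷ Δ)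
exts σ Z     = var Z
exts σ (S x) = rename S (σ x)

subst : ∀ {Γ Δ A} → Sub Γ Δ → Tm Γ A → Tm Δ A
subst σ (var x)   = σ x
subst σ (lam t)   = lam (subst (exts σ) t)
subst σ (app t u) = app (subst σ t) (subst σ u)

_[_] : ∀ {Γ A B} → Tm (B ∷ Γ) A → Tm Γ B → Tm Γ A
_[_] {Γ} {A} {B} t s = subst σ t
  where
  σ : Sub (B ∷ Γ) Γ
  σ Z     = s
  σ (S x) = var x

-- General one-hole contexts.  Cx Γ τ Δ σ : a term of type τ in Γ whose
-- hole expects a term of type σ in context Δ (Δ = Γ + binders crossed).

data Cx : Ctx → Ty → Ctx → Ty → Set where
  hole : ∀ {Γ τ} → Cx Γ τ Γ τ
  lamC : ∀ {Γ A B Δ σ} → Cx (A ∷ Γ) B Δ σ → Cx Γ (A ⇒ B) Δ σ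
  appL : ∀ {Γ A B Δ σ} → Cx Γ (A ⇒ B) Δ σ → Tm Γ A → Cx Γ B Δ σ
  appR : ∀ {Γ A B Δ σ} → Tm Γ (A ⇒ B) → Cx Γ A Δ σ → Cx Γ B Δ σ

plug : ∀ {Γ τ Δ σ} → Cx Γ τ Δ σ → Tm Δ σ → Tm Γ τ
plug hole       u = u
plug (lamC C)   u = lam (plug C u)
plug (appL C t) u = app (plug C u) t
plug (appR t C) u = app t (plug C u)

wkC : ∀ {Γ τ Δ σ} → Cx Γ τ Δ σ → Ren Γ Δ
wkC hole       x = x
wkC (lamC C)   x = wkC C (S x)
wkC (appL C t) x = wkC C x
wkC (appR t C) x = wkC C x

data HCx : Ctx → Ty → Ctx → Ty → Set where
  holeH : ∀ {Γ τ} → HCx Γ τ Γ τ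
  lamH  : ∀ {Γ A B Δ σ} → HCx (A ∷ Γ) B Δ σ → HCx Γ (A ⇒ B) Δ σ
  appH  : ∀ {Γ A B Δ σ} → HCx Γ (A ⇒ B) Δ σ → Tm Γ A → HCx Γ B Δ σ

plugH : ∀ {Γ τ Δ σ} → HCx Γ τ Δ σ → Tm Δ σ → Tm Γ τ
plugH holeH      u = u
plugH (lamH H)   u = lam (plugH H u)
plugH (appH H t) u = app (plugH H u) t

wkH : ∀ {Γ τ Δ σ} → HCx Γ τ Δ σ → Ren Γ Δ
wkH holeH      x = x
wkH (lamH H)   x = wkH H (S x)
wkH (appH H t) x = wkH H x

-- E-contexts:  E ::= □ | E₁[λx.E₂] t.
-- In the simply typed setting an E-context is type-generic: if u : A
-- then E[u] : A (each λ of E is matched with its own argument).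
-- ECx Γ Δ : outer context Γ, hole context Δ.

data ECx : Ctx → Ctx → Set where
  holeE : ∀ {Γ} → ECx Γ Γ
  extE  : ∀ {Γ Γ' Δ A} → ECx Γ Γ' → ECx (A ∷ Γ') Δ → Tm Γ A → ECx Γ Δ

plugE : ∀ {Γ Δ B} → ECx Γ Δ → Tm Δ B → Tm Γ B
plugE holeE           u = u
plugE (extE E₁ E₂ t)  u = app (plugE E₁ (lam (plugE E₂ u))) t

wkE : ∀ {Γ Δ} → ECx Γ Δ → Ren Γ Δ
wkE holeE          x = x
wkE (extE E₁ E₂ t) x = wkE E₂ (S (wkE E₁ x))

Rel : Set₁
Rel = ∀ {Γ τ} → Tm Γ τ → Tm Γ τ → Set

data Comp (R : Rel) {Γ τ} : Tm Γ τ → Tm Γ τ → Set where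
  comp : ∀ {Δ σ} (C : Cx Γ τ Δ σ) {l r : Tm Δ σ} →
         R l r → Comp R (plug C l) (plug C r)

data HComp (R : Rel) {Γ τ} : Tm Γ τ → Tm Γ τ → Set where
  hcomp : ∀ {Δ σ} (H : HCx Γ τ Δ σ) {l r : Tm Δ σ} →
          R l r → HComp R (plugH H l) (plugH H r)

data βRoot {Γ τ} : Tm Γ τ → Tm Γ τ → Set where
  β : ∀ {A} (t : Tm (A ∷ Γ) τ) (s : Tm Γ A) → βRoot (app (lam t) s) (t [ s ])

-- E[λx.t] s → E[t{s/x}]   (s weakened past the binders of E)
data βdRoot {Γ τ} : Tm Γ τ → Tm Γ τ → Set where
  βd : ∀ {Δ A} (E : ECx Γ Δ) (t : Tm (A ∷ Δ) τ) (s : Tm Γ A) →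
       βdRoot (app (plugE E (lam t)) s) (plugE E (t [ rename (wkE E) s ]))

-- E[λx.C[x]] s ⊸ E[λx.C[s']] s
data ⊸Root {Γ τ} : Tm Γ τ → Tm Γ τ → Set where
  lin : ∀ {Δ A Θ} (E : ECx Γ Δ) (C : Cx (A ∷ Δ) τ Θ A) (s : Tm Γ A) →
        ⊸Root (app (plugE E (lam (plug C (var (wkC C Z))))) s)
              (app (plugE E (lam (plug C (rename (λ x → wkC C (S (wkE E x))) s)))) s)

-- E[λx.t] s → E[t] when x ∉ FV(t)  (t is the weakening of a term of Δ)
data gRoot {Γ τ} : Tm Γ τ → Tm Γ τ → Set where
  gc : ∀ {Δ A} (E : ECx Γ Δ) (t : Tm Δ τ) (s : Tm Γ A) →
       gRoot (app (plugE E (lam (rename (S {B = A}) t))) s) (plugE E t)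

-- E[λx.H[x]] s ⊸_h E[λx.H[s']] s
data ⊸hRoot {Γ τ} : Tm Γ τ → Tm Γ τ → Set where
  linh : ∀ {Δ A Θ} (E : ECx Γ Δ) (H : HCx (A ∷ Δ) τ Θ A) (s : Tm Γ A) →
         ⊸hRoot (app (plugE E (lam (plugH H (var (wkH H Z))))) s)
                (app (plugE E (lam (plugH H (rename (λ x → wkH H (S (wkE E x))) s)))) s)

-- Head reduction:
-- λy₁…λy_k.(λx.t) s u₁…u_h → λy₁…λy_k.t{s/x} u₁…u_h

data ACx (Γ : Ctx) : Ty → Ty → Set where
  holeA : ∀ {τ} → ACx Γ τ τ
  appA  : ∀ {A B σ} → ACx Γ (A ⇒ B) σ → Tm Γ A → ACx Γ B σ

plugA : ∀ {Γ τ σ} → ACx Γ τ σ → Tm Γ σ → Tm Γ τ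
plugA holeA      u = u
plugA (appA A t) u = app (plugA A u) t

data LCx : Ctx → Ty → Ctx → Ty → Set where
  holeL : ∀ {Γ τ} → LCx Γ τ Γ τ
  lamL  : ∀ {Γ A B Δ σ} → LCx (A ∷ Γ) B Δ σ → LCx Γ (A ⇒ B) Δ σ

plugL : ∀ {Γ τ Δ σ} → LCx Γ τ Δ σ → Tm Δ σ → Tm Γ τ
plugL holeL    u = u
plugL (lamL L) u = lam (plugL L u)

data _→h_ {Γ τ} : Tm Γ τ → Tm Γ τ → Set where
  head : ∀ {Δ σ ρ A} (L : LCx Γ τ Δ σ) (As : ACx Δ σ ρ)
         (t : Tm (A ∷ Δ) ρ) (s : Tm Δ A) →
         plugL L (plugA As (app (lam t) s)) →h plugL L (plugA As (t [ s ]))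

_→β_ : Rel
_→β_ = Comp βRoot

_→βd_ : Rel
_→βd_ = Comp βdRoot

_⊸_ : Rel
_⊸_ = Comp ⊸Root

_→g_ : Rel
_→g_ = Comp gRoot

data _→a_ {Γ τ} (t u : Tm Γ τ) : Set where
  a-lin : t ⊸ u  → t →a u
  a-g   : t →g u → t →a u

_⊸h_ : Rel
_⊸h_ = HComp ⊸hRoot

SN : Rel → ∀ {Γ τ} → Tm Γ τ → Set
SN R {Γ} {τ} t =
  ¬ (Σ (ℕ → Tm Γ τ) λ f → (f 0 ≡ t) × (∀ n → R (f n) (f (suc n))))

-- Gandy's hereditarily monotone functionals.  Terms are interpreted, in
-- environments of strict functionals (hereditarily monotone and strictly
-- monotone), as strict functionals; λx.t sends v to ⟦t⟧ at x := v + 1, plus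
-- |v| + 1, where |v| ∈ ℕ is v applied to the least strict functionals.  The
-- + 1 on the bound variable makes a fresh copy of s smaller than the
-- occurrence of x it replaces (⊸, ⊸h), and the bonus |v| + 1 pays for
-- consuming the redex (β, βd, h, g).  So every step of every system strictly
-- decreases the interpretation, hence the number |⟦t⟧|.
module Submission where

open import Defs
open import Data.List using (_∷_)
open import Data.Nat using (ℕ; suc; _+_; _≤_; _<_; z≤n; s≤s)
open import Data.Nat.Induction using (<-wellFounded)
open import Data.Nat.Properties
  using (≤-refl; ≤-trans; ≤-reflexive; <⇒≤; ≤-<-trans; <-≤-trans; +-mono-≤;
         +-mono-<-≤; +-mono-≤-<; +-assoc; +-identityʳ; m<m+n)
open import Data.Product using (∃-syntax; _×_; _,_; proj₁; proj₂)
open import Data.Unit using (⊤; tt)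
open import Function using (_∘_)
open import Induction.InfiniteDescent
  using (InfiniteDescendingSequence; InfiniteDescendingSequenceFrom; Descent; descent∧wf⇒empty)
open import Relation.Nullary using (¬_)
open import Relation.Binary.PropositionalEquality
  using (_≡_; refl; sym; trans)
  renaming (subst to ≡-subst)

private
  variable
    Γ Δ Θ : Ctx
    A B τ σ : Ty

⟦_⟧ : Ty → Set
⟦ o ⟧     = ℕ
⟦ A ⇒ B ⟧ = ⟦ A ⟧ → ⟦ B ⟧

mutual
  Strict : (A : Ty) → ⟦ A ⟧ → Set
  Strict o       _ = ⊤
  Strict (A ⇒ B) f =
    (∀ {a} → Strict A a → Strict B (f a)) ×
    (∀ {a b} → Strict A a → Strict A b → Le A a b → Le B (f a) (f b)) ×
    (∀ {a b} → Strict A a → Strict A b → Lt A a b → Lt B (f a) (f b))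

  Le : (A : Ty) → ⟦ A ⟧ → ⟦ A ⟧ → Set
  Le o       m n = m ≤ n
  Le (A ⇒ B) f g = ∀ a → Strict A a → Le B (f a) (g a)

  Lt : (A : Ty) → ⟦ A ⟧ → ⟦ A ⟧ → Set
  Lt o       m n = m < n
  Lt (A ⇒ B) f g = ∀ a → Strict A a → Lt B (f a) (g a)

module _ {A B : Ty} {f : ⟦ A ⟧ → ⟦ B ⟧} (hf : Strict (A ⇒ B) f) where

  strict-app : ∀ {a} → Strict A a → Strict B (f a)
  strict-app = proj₁ hf

  strict-mono-≤ : ∀ {a b} → Strict A a → Strict A b → Le A a b → Le B (f a) (f b)
  strict-mono-≤ = proj₁ (proj₂ hf)

  strict-mono-< : ∀ {a b} → Strict A a → Strict A b → Lt A a b → Lt B (f a) (f b)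
  strict-mono-< = proj₂ (proj₂ hf)

Le-refl : ∀ A (x : ⟦ A ⟧) → Le A x x
Le-refl o       x = ≤-refl
Le-refl (A ⇒ B) f = λ a _ → Le-refl B (f a)

≡⇒Le : ∀ A {x y : ⟦ A ⟧} → x ≡ y → Le A x y
≡⇒Le A {x} refl = Le-refl A x

Le-trans : ∀ A {x y z : ⟦ A ⟧} → Le A x y → Le A y z → Le A x z
Le-trans o       p q = ≤-trans p q
Le-trans (A ⇒ B) p q = λ a h → Le-trans B (p a h) (q a h)

Lt⇒Le : ∀ A {x y : ⟦ A ⟧} → Lt A x y → Le A x y
Lt⇒Le o       p = <⇒≤ p
Lt⇒Le (A ⇒ B) p = λ a h → Lt⇒Le B (p a h)

Le-Lt-trans : ∀ A {x y z : ⟦ A ⟧} → Le A x y → Lt A y z → Lt A x z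
Le-Lt-trans o       p q = ≤-<-trans p q
Le-Lt-trans (A ⇒ B) p q = λ a h → Le-Lt-trans B (p a h) (q a h)

Lt-Le-trans : ∀ A {x y z : ⟦ A ⟧} → Lt A x y → Le A y z → Lt A x z
Lt-Le-trans o       p q = <-≤-trans p q
Lt-Le-trans (A ⇒ B) p q = λ a h → Lt-Le-trans B (p a h) (q a h)

plus : (A : Ty) → ⟦ A ⟧ → ℕ → ⟦ A ⟧
plus o       x n = x + n
plus (A ⇒ B) f n = λ a → plus B (f a) n

plus-mono-≤ : ∀ A {x y : ⟦ A ⟧} {m n} → Le A x y → m ≤ n → Le A (plus A x m) (plus A y n)
plus-mono-≤ o       p q = +-mono-≤ p q
plus-mono-≤ (A ⇒ B) p q = λ a h → plus-mono-≤ B (p a h) q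

plus-mono-<-≤ : ∀ A {x y : ⟦ A ⟧} {m n} → Lt A x y → m ≤ n → Lt A (plus A x m) (plus A y n)
plus-mono-<-≤ o       p q = +-mono-<-≤ p q
plus-mono-<-≤ (A ⇒ B) p q = λ a h → plus-mono-<-≤ B (p a h) q

plus-mono-≤-< : ∀ A {x y : ⟦ A ⟧} {m n} → Le A x y → m < n → Lt A (plus A x m) (plus A y n)
plus-mono-≤-< o       p q = +-mono-≤-< p q
plus-mono-≤-< (A ⇒ B) p q = λ a h → plus-mono-≤-< B (p a h) q

Le⇒Lt-plus-suc : ∀ A {x y : ⟦ A ⟧} m → Le A x y → Lt A x (plus A y (suc m))
Le⇒Lt-plus-suc o       m p = ≤-<-trans p (m<m+n _ (s≤s z≤n))
Le⇒Lt-plus-suc (A ⇒ B) m p = λ a h → Le⇒Lt-plus-suc B m (p a h)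

Le-plus-1 : ∀ A (x : ⟦ A ⟧) → Le A x (plus A x 1)
Le-plus-1 A x = Lt⇒Le A (Le⇒Lt-plus-suc A 0 (Le-refl A x))

plus-strict : ∀ A {x : ⟦ A ⟧} n → Strict A x → Strict A (plus A x n)
plus-strict o       n _ = tt
plus-strict (A ⇒ B) n h =
  (λ ha → plus-strict B n (strict-app h ha)) ,
  (λ ha hb p → plus-mono-≤ B (strict-mono-≤ h ha hb p) ≤-refl) ,
  (λ ha hb p → plus-mono-<-≤ B (strict-mono-< h ha hb p) ≤-refl)

plus-identityʳ-≤ : ∀ A (x : ⟦ A ⟧) → Le A (plus A x 0) x
plus-identityʳ-≤ o       x = ≤-reflexive (+-identityʳ x)
plus-identityʳ-≤ (A ⇒ B) f = λ a _ → plus-identityʳ-≤ B (f a)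

plus-identityʳ-≥ : ∀ A (x : ⟦ A ⟧) → Le A x (plus A x 0)
plus-identityʳ-≥ o       x = ≤-reflexive (sym (+-identityʳ x))
plus-identityʳ-≥ (A ⇒ B) f = λ a _ → plus-identityʳ-≥ B (f a)

+-assoc³ : ∀ x a b c → ((x + a) + b) + c ≡ x + (a + (b + c))
+-assoc³ x a b c = trans (+-assoc (x + a) b c) (+-assoc x a (b + c))

plus-assoc-≤ : ∀ A (x : ⟦ A ⟧) a b c →
               Le A (plus A (plus A (plus A x a) b) c) (plus A x (a + (b + c)))
plus-assoc-≤ o       x a b c = ≤-reflexive (+-assoc³ x a b c)
plus-assoc-≤ (A ⇒ B) f a b c = λ v _ → plus-assoc-≤ B (f v) a b c

plus-assoc-≥ : ∀ A (x : ⟦ A ⟧) a b c →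
               Le A (plus A x (a + (b + c))) (plus A (plus A (plus A x a) b) c)
plus-assoc-≥ o       x a b c = ≤-reflexive (sym (+-assoc³ x a b c))
plus-assoc-≥ (A ⇒ B) f a b c = λ v _ → plus-assoc-≥ B (f v) a b c

mutual
  toℕ : (A : Ty) → ⟦ A ⟧ → ℕ
  toℕ o       n = n
  toℕ (A ⇒ B) f = toℕ B (f (fromℕ A 0))

  fromℕ : (A : Ty) → ℕ → ⟦ A ⟧
  fromℕ o       n = n
  fromℕ (A ⇒ B) n = λ a → fromℕ B (n + toℕ A a)

fromℕ-mono-≤ : ∀ A {m n} → m ≤ n → Le A (fromℕ A m) (fromℕ A n)
fromℕ-mono-≤ o       p = p
fromℕ-mono-≤ (A ⇒ B) p = λ a _ → fromℕ-mono-≤ B (+-mono-≤ p ≤-refl)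

fromℕ-mono-< : ∀ A {m n} → m < n → Lt A (fromℕ A m) (fromℕ A n)
fromℕ-mono-< o       p = p
fromℕ-mono-< (A ⇒ B) p = λ a _ → fromℕ-mono-< B (+-mono-<-≤ p ≤-refl)

mutual
  fromℕ-strict : ∀ A n → Strict A (fromℕ A n)
  fromℕ-strict o       n = tt
  fromℕ-strict (A ⇒ B) n =
    (λ _ → fromℕ-strict B _) ,
    (λ _ _ p → fromℕ-mono-≤ B (+-mono-≤ (≤-refl {n}) (toℕ-mono-≤ A p))) ,
    (λ _ _ p → fromℕ-mono-< B (+-mono-≤-< (≤-refl {n}) (toℕ-mono-< A p)))

  toℕ-mono-≤ : ∀ A {x y : ⟦ A ⟧} → Le A x y → toℕ A x ≤ toℕ A y
  toℕ-mono-≤ o       p = p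
  toℕ-mono-≤ (A ⇒ B) p = toℕ-mono-≤ B (p (fromℕ A 0) (fromℕ-strict A 0))

  toℕ-mono-< : ∀ A {x y : ⟦ A ⟧} → Lt A x y → toℕ A x < toℕ A y
  toℕ-mono-< o       p = p
  toℕ-mono-< (A ⇒ B) p = toℕ-mono-< B (p (fromℕ A 0) (fromℕ-strict A 0))

Env : Ctx → Set
Env Γ = ∀ {A} → Γ ∋ A → ⟦ A ⟧

StrictEnv : Env Γ → Set
StrictEnv {Γ} ρ = ∀ {A} (x : Γ ∋ A) → Strict A (ρ x)

_≤ᴱ_ : Env Γ → Env Γ → Set
_≤ᴱ_ {Γ} ρ ρ' = ∀ {A} (x : Γ ∋ A) → Le A (ρ x) (ρ' x)

_≗ᴱ_ : Env Γ → Env Γ → Set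
_≗ᴱ_ {Γ} ρ ρ' = ∀ {A} (x : Γ ∋ A) → ρ x ≡ ρ' x

_⊙_ : Env Δ → Ren Γ Δ → Env Γ
(ρ ⊙ r) x = ρ (r x)

_▸_ : Env Γ → ⟦ A ⟧ → Env (A ∷ Γ)
(ρ ▸ v) Z     = v
(ρ ▸ v) (S x) = ρ x

≗ᴱ⇒≤ᴱ : {ρ ρ' : Env Γ} → ρ ≗ᴱ ρ' → ρ ≤ᴱ ρ'
≗ᴱ⇒≤ᴱ eq {A} x = ≡⇒Le A (eq x)

▸-mono-≤ : {ρ ρ' : Env Γ} {v w : ⟦ A ⟧} → ρ ≤ᴱ ρ' → Le A v w → (ρ ▸ v) ≤ᴱ (ρ' ▸ w)
▸-mono-≤ _ p Z     = p
▸-mono-≤ h _ (S x) = h x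

▸-strict : {ρ : Env Γ} {v : ⟦ A ⟧} → StrictEnv ρ → Strict A v → StrictEnv (ρ ▸ v)
▸-strict _  hv Z     = hv
▸-strict hρ _  (S x) = hρ x

▸+1-strict : {ρ : Env Γ} {v : ⟦ A ⟧} → StrictEnv ρ → Strict A v → StrictEnv (ρ ▸ plus A v 1)
▸+1-strict {A = A} hρ hv = ▸-strict hρ (plus-strict A 1 hv)

≤ᴱ-refl : (ρ : Env Γ) → ρ ≤ᴱ ρ
≤ᴱ-refl ρ {A} x = Le-refl A (ρ x)

≤ᴱ-trans : {ρ ρ' ρ'' : Env Γ} → ρ ≤ᴱ ρ' → ρ' ≤ᴱ ρ'' → ρ ≤ᴱ ρ''
≤ᴱ-trans h h' {A} x = Le-trans A (h x) (h' x)

⊙-ext : (ρ : Env Δ) (r : Ren Γ Δ) (v : ⟦ A ⟧) → ((ρ ▸ v) ⊙ ext r) ≗ᴱ ((ρ ⊙ r) ▸ v)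
⊙-ext ρ r v Z     = refl
⊙-ext ρ r v (S x) = refl

eval : Tm Γ A → Env Γ → ⟦ A ⟧
eval                (var x)   ρ = ρ x
eval {A = A ⇒ B}    (lam t)   ρ = λ v → plus B (eval t (ρ ▸ plus A v 1)) (suc (toℕ A v))
eval                (app t u) ρ = eval t ρ (eval u ρ)

mutual
  eval-strict : (t : Tm Γ A) {ρ : Env Γ} → StrictEnv ρ → Strict A (eval t ρ)
  eval-strict (var x)   hρ = hρ x
  eval-strict (app t u) hρ = strict-app (eval-strict t hρ) (eval-strict u hρ)
  eval-strict {A = A ⇒ B} (lam t) {ρ} hρ =
    (λ ha → plus-strict B _ (eval-strict t (▸+1-strict hρ ha))) ,
    (λ ha hb p → plus-mono-≤ B (body-mono ha hb (plus-mono-≤ A p ≤-refl))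
                               (s≤s (toℕ-mono-≤ A p))) ,
    (λ ha hb p → plus-mono-≤-< B (body-mono ha hb (plus-mono-≤ A (Lt⇒Le A p) ≤-refl))
                                 (s≤s (toℕ-mono-< A p)))
    where
    body-mono : ∀ {a b} → Strict A a → Strict A b → Le A (plus A a 1) (plus A b 1) →
                Le B (eval t (ρ ▸ plus A a 1)) (eval t (ρ ▸ plus A b 1))
    body-mono ha hb p =
      eval-mono-≤ t (▸+1-strict hρ ha) (▸+1-strict hρ hb) (▸-mono-≤ (≤ᴱ-refl ρ) p)

  eval-mono-≤ : (t : Tm Γ A) {ρ ρ' : Env Γ} → StrictEnv ρ → StrictEnv ρ' →
                ρ ≤ᴱ ρ' → Le A (eval t ρ) (eval t ρ')
  eval-mono-≤ (var x) _ _ h = h x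
  eval-mono-≤ {A = B} (app t u) hρ hρ' h =
    Le-trans B (strict-mono-≤ (eval-strict t hρ) (eval-strict u hρ) (eval-strict u hρ')
                              (eval-mono-≤ u hρ hρ' h))
               (eval-mono-≤ t hρ hρ' h _ (eval-strict u hρ'))
  eval-mono-≤ {A = A ⇒ B} (lam t) hρ hρ' h = λ a ha →
    plus-mono-≤ B (eval-mono-≤ t (▸+1-strict hρ ha) (▸+1-strict hρ' ha)
                                 (▸-mono-≤ h (Le-refl A (plus A a 1))))
                  ≤-refl

eval-rename-≤ : (t : Tm Γ A) (r : Ren Γ Δ) {ρ : Env Δ} {ρ' : Env Γ} →
                StrictEnv ρ → StrictEnv ρ' → (ρ ⊙ r) ≤ᴱ ρ' →
                Le A (eval (rename r t) ρ) (eval t ρ')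
eval-rename-≤ (var x) r _ _ h = h x
eval-rename-≤ {A = B} (app t u) r hρ hρ' h =
  Le-trans B (strict-mono-≤ (eval-strict (rename r t) hρ) (eval-strict (rename r u) hρ)
                            (eval-strict u hρ') (eval-rename-≤ u r hρ hρ' h))
             (eval-rename-≤ t r hρ hρ' h _ (eval-strict u hρ'))
eval-rename-≤ {A = A ⇒ B} (lam t) r {ρ} hρ hρ' h = λ a ha →
  plus-mono-≤ B (eval-rename-≤ t (ext r) (▸+1-strict hρ ha) (▸+1-strict hρ' ha)
                   (≤ᴱ-trans (≗ᴱ⇒≤ᴱ (⊙-ext ρ r _)) (▸-mono-≤ h (Le-refl A (plus A a 1)))))
                ≤-refl

eval-rename-≥ : (t : Tm Γ A) (r : Ren Γ Δ) {ρ : Env Δ} {ρ' : Env Γ} →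
                StrictEnv ρ → StrictEnv ρ' → ρ' ≤ᴱ (ρ ⊙ r) →
                Le A (eval t ρ') (eval (rename r t) ρ)
eval-rename-≥ (var x) r _ _ h = h x
eval-rename-≥ {A = B} (app t u) r hρ hρ' h =
  Le-trans B (strict-mono-≤ (eval-strict t hρ') (eval-strict u hρ')
                            (eval-strict (rename r u) hρ) (eval-rename-≥ u r hρ hρ' h))
             (eval-rename-≥ t r hρ hρ' h _ (eval-strict (rename r u) hρ))
eval-rename-≥ {A = A ⇒ B} (lam t) r {ρ} hρ hρ' h = λ a ha →
  plus-mono-≤ B (eval-rename-≥ t (ext r) (▸+1-strict hρ ha) (▸+1-strict hρ' ha)
                   (≤ᴱ-trans (▸-mono-≤ h (Le-refl A (plus A a 1)))
                             (≗ᴱ⇒≤ᴱ (sym ∘ ⊙-ext ρ r _))))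
                ≤-refl

eval-subst-≤ : (t : Tm Γ A) (σ : Sub Γ Δ) {ρ : Env Δ} {ρ' : Env Γ} →
               StrictEnv ρ → StrictEnv ρ' → (∀ {B} (x : Γ ∋ B) → Le B (eval (σ x) ρ) (ρ' x)) →
               Le A (eval (subst σ t) ρ) (eval t ρ')
eval-subst-≤ (var x) σ _ _ h = h x
eval-subst-≤ {A = B} (app t u) σ hρ hρ' h =
  Le-trans B (strict-mono-≤ (eval-strict (subst σ t) hρ) (eval-strict (subst σ u) hρ)
                            (eval-strict u hρ') (eval-subst-≤ u σ hρ hρ' h))
             (eval-subst-≤ t σ hρ hρ' h _ (eval-strict u hρ'))
eval-subst-≤ {A = A ⇒ B} (lam t) σ {ρ} {ρ'} hρ hρ' h = λ a ha →
  plus-mono-≤ B (eval-subst-≤ t (exts σ) (▸+1-strict hρ ha) (▸+1-strict hρ' ha) (exts-≤ ha))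
                ≤-refl
  where
  exts-≤ : ∀ {a} → Strict A a → ∀ {C} (x : (A ∷ _) ∋ C) →
           Le C (eval (exts σ x) (ρ ▸ plus A a 1)) ((ρ' ▸ plus A a 1) x)
  exts-≤ {a} _  Z     = Le-refl A (plus A a 1)
  exts-≤     ha (S {A = C} x) =
    Le-trans C (eval-rename-≤ (σ x) S (▸+1-strict hρ ha) hρ (≤ᴱ-refl ρ)) (h x)

eval-[]-≤ : (t : Tm (A ∷ Γ) B) (s : Tm Γ A) {ρ : Env Γ} {v : ⟦ A ⟧} →
            StrictEnv ρ → Strict A v → Le A (eval s ρ) v →
            Le B (eval (t [ s ]) ρ) (eval t (ρ ▸ v))
eval-[]-≤ t s {ρ} hρ hv p =
  eval-subst-≤ t _ hρ (▸-strict hρ hv) (λ { Z → p ; (S {A = C} x) → Le-refl C (ρ x) })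

holeEnv : ECx Γ Δ → Env Γ → Env Δ
holeEnv holeE                  ρ = ρ
holeEnv (extE {A = A} E₁ E₂ a) ρ = holeEnv E₂ (holeEnv E₁ ρ ▸ plus A (eval a ρ) 1)

holeBonus : ECx Γ Δ → Env Γ → ℕ
holeBonus holeE                  ρ = 0
holeBonus (extE {A = A} E₁ E₂ a) ρ =
  holeBonus E₂ (holeEnv E₁ ρ ▸ plus A (eval a ρ) 1) + (suc (toℕ A (eval a ρ)) + holeBonus E₁ ρ)

holeEnv-strict : (E : ECx Γ Δ) {ρ : Env Γ} → StrictEnv ρ → StrictEnv (holeEnv E ρ)
holeEnv-strict holeE          hρ = hρ
holeEnv-strict (extE E₁ E₂ a) hρ =
  holeEnv-strict E₂ (▸+1-strict (holeEnv-strict E₁ hρ) (eval-strict a hρ))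

holeEnv-wkE : (E : ECx Γ Δ) (ρ : Env Γ) → (holeEnv E ρ ⊙ wkE E) ≗ᴱ ρ
holeEnv-wkE holeE                  ρ x = refl
holeEnv-wkE (extE {A = A} E₁ E₂ a) ρ x =
  trans (holeEnv-wkE E₂ (holeEnv E₁ ρ ▸ plus A (eval a ρ) 1) (S (wkE E₁ x)))
        (holeEnv-wkE E₁ ρ x)

eval-plugE-≤ : (E : ECx Γ Δ) (u : Tm Δ B) {ρ : Env Γ} → StrictEnv ρ →
               Le B (eval (plugE E u) ρ) (plus B (eval u (holeEnv E ρ)) (holeBonus E ρ))
eval-plugE-≤ {B = B} holeE u {ρ} _ = plus-identityʳ-≥ B (eval u ρ)
eval-plugE-≤ {B = B} (extE {A = A} E₁ E₂ a) u {ρ} hρ =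
  Le-trans B (eval-plugE-≤ E₁ (lam (plugE E₂ u)) hρ (eval a ρ) (eval-strict a hρ))
    (Le-trans B (plus-mono-≤ B (plus-mono-≤ B (eval-plugE-≤ E₂ u hρ₁) ≤-refl) ≤-refl)
                (plus-assoc-≤ B _ _ _ _))
  where
  hρ₁ = ▸+1-strict (holeEnv-strict E₁ hρ) (eval-strict a hρ)

eval-plugE-≥ : (E : ECx Γ Δ) (u : Tm Δ B) {ρ : Env Γ} → StrictEnv ρ →
               Le B (plus B (eval u (holeEnv E ρ)) (holeBonus E ρ)) (eval (plugE E u) ρ)
eval-plugE-≥ {B = B} holeE u {ρ} _ = plus-identityʳ-≤ B (eval u ρ)
eval-plugE-≥ {B = B} (extE {A = A} E₁ E₂ a) u {ρ} hρ =
  Le-trans B (plus-assoc-≥ B _ _ _ _)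
    (Le-trans B (plus-mono-≤ B (plus-mono-≤ B (eval-plugE-≥ E₂ u hρ₁) ≤-refl) ≤-refl)
                (eval-plugE-≥ E₁ (lam (plugE E₂ u)) hρ (eval a ρ) (eval-strict a hρ)))
  where
  hρ₁ = ▸+1-strict (holeEnv-strict E₁ hρ) (eval-strict a hρ)

infix 4 _≻_

record _≻_ {Γ τ} (t t' : Tm Γ τ) : Set where
  constructor mk≻
  field decreases : (ρ : Env Γ) → StrictEnv ρ → Lt τ (eval t' ρ) (eval t ρ)

open _≻_

≻-lam : {u u' : Tm (A ∷ Γ) B} → u ≻ u' → lam u ≻ lam u'
≻-lam {A = A} {B = B} d = mk≻ λ ρ hρ a ha →
  plus-mono-<-≤ B (decreases d (ρ ▸ plus A a 1) (▸+1-strict hρ ha)) ≤-refl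

≻-appˡ : {u u' : Tm Γ (A ⇒ B)} (t : Tm Γ A) → u ≻ u' → app u t ≻ app u' t
≻-appˡ t d = mk≻ λ ρ hρ → decreases d ρ hρ (eval t ρ) (eval-strict t hρ)

plug-< : (C : Cx Γ τ Δ σ) (u u' : Tm Δ σ) {ρ : Env Γ} → StrictEnv ρ →
         ((θ : Env Δ) → StrictEnv θ → (θ ⊙ wkC C) ≗ᴱ ρ → Lt σ (eval u' θ) (eval u θ)) →
         Lt τ (eval (plug C u') ρ) (eval (plug C u) ρ)
plug-< hole u u' {ρ} hρ h = h ρ hρ (λ _ → refl)
plug-< (lamC {A = A} {B = B} C) u u' hρ h = λ a ha →
  plus-mono-<-≤ B (plug-< C u u' (▸+1-strict hρ ha) (λ θ hθ eq → h θ hθ (eq ∘ S))) ≤-refl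
plug-< (appL C t) u u' {ρ} hρ h = plug-< C u u' hρ h (eval t ρ) (eval-strict t hρ)
plug-< (appR t C) u u' hρ h =
  strict-mono-< (eval-strict t hρ) (eval-strict (plug C u') hρ) (eval-strict (plug C u) hρ)
                (plug-< C u u' hρ h)

plugH-< : (H : HCx Γ τ Δ σ) (u u' : Tm Δ σ) {ρ : Env Γ} → StrictEnv ρ →
          ((θ : Env Δ) → StrictEnv θ → (θ ⊙ wkH H) ≗ᴱ ρ → Lt σ (eval u' θ) (eval u θ)) →
          Lt τ (eval (plugH H u') ρ) (eval (plugH H u) ρ)
plugH-< holeH u u' {ρ} hρ h = h ρ hρ (λ _ → refl)
plugH-< (lamH {A = A} {B = B} H) u u' hρ h = λ a ha →
  plus-mono-<-≤ B (plugH-< H u u' (▸+1-strict hρ ha) (λ θ hθ eq → h θ hθ (eq ∘ S))) ≤-refl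
plugH-< (appH H t) u u' {ρ} hρ h = plugH-< H u u' hρ h (eval t ρ) (eval-strict t hρ)

Comp-≻ : {R : Rel} → (∀ {Γ τ} {l r : Tm Γ τ} → R l r → l ≻ r) →
         {t t' : Tm Γ τ} → Comp R t t' → t ≻ t'
Comp-≻ root (comp C {l} {r} p) =
  mk≻ λ ρ hρ → plug-< C l r hρ λ θ hθ _ → decreases (root p) θ hθ

HComp-≻ : {R : Rel} → (∀ {Γ τ} {l r : Tm Γ τ} → R l r → l ≻ r) →
          {t t' : Tm Γ τ} → HComp R t t' → t ≻ t'
HComp-≻ root (hcomp H {l} {r} p) =
  mk≻ λ ρ hρ → plugH-< H l r hρ λ θ hθ _ → decreases (root p) θ hθ

plugA-≻ : (As : ACx Γ τ σ) {l r : Tm Γ σ} → l ≻ r → plugA As l ≻ plugA As r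
plugA-≻ holeA       d = d
plugA-≻ (appA As t) d = ≻-appˡ t (plugA-≻ As d)

plugL-≻ : (L : LCx Γ τ Δ σ) {l r : Tm Δ σ} → l ≻ r → plugL L l ≻ plugL L r
plugL-≻ holeL    d = d
plugL-≻ (lamL L) d = ≻-lam (plugL-≻ L d)

redexEnv : ECx Γ Δ → Tm Γ A → Env Γ → Env (A ∷ Δ)
redexEnv {A = A} E s ρ = holeEnv E ρ ▸ plus A (eval s ρ) 1

redexEnv-strict : (E : ECx Γ Δ) (s : Tm Γ A) {ρ : Env Γ} → StrictEnv ρ →
                  StrictEnv (redexEnv E s ρ)
redexEnv-strict E s hρ = ▸+1-strict (holeEnv-strict E hρ) (eval-strict s hρ)

redex-≻ : (E : ECx Γ Δ) (b b' : Tm (A ∷ Δ) τ) (s : Tm Γ A) →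
          ((ρ : Env Γ) → StrictEnv ρ → Lt τ (eval b' (redexEnv E s ρ)) (eval b (redexEnv E s ρ))) →
          app (plugE E (lam b)) s ≻ app (plugE E (lam b')) s
redex-≻ {τ = τ} E b b' s b'<b = mk≻ λ ρ hρ →
  Le-Lt-trans τ (eval-plugE-≤ E (lam b') hρ (eval s ρ) (eval-strict s hρ))
    (Lt-Le-trans τ (plus-mono-<-≤ τ (plus-mono-<-≤ τ (b'<b ρ hρ) ≤-refl) ≤-refl)
                   (eval-plugE-≥ E (lam b) hρ (eval s ρ) (eval-strict s hρ)))

-- A fresh copy of s is worth at most ⟦s⟧, the variable it replaces ⟦s⟧ + 1.
copy-< : (E : ECx Γ Δ) (s : Tm Γ A) {ρ : Env Γ} → StrictEnv ρ →
         (wk : Ren (A ∷ Δ) Θ) {θ : Env Θ} → StrictEnv θ → (θ ⊙ wk) ≗ᴱ redexEnv E s ρ →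
         Lt A (eval (rename (λ x → wk (S (wkE E x))) s) θ) (θ (wk Z))
copy-< {A = A} E s {ρ} hρ wk hθ eq =
  ≡-subst (Lt A _) (sym (eq Z))
    (Le⇒Lt-plus-suc A 0
      (eval-rename-≤ s _ hθ hρ (≗ᴱ⇒≤ᴱ λ x → trans (eq (S (wkE E x))) (holeEnv-wkE E ρ x))))

⊸Root-≻ : {t t' : Tm Γ τ} → ⊸Root t t' → t ≻ t'
⊸Root-≻ (lin E C s) = redex-≻ E _ _ s λ ρ hρ →
  plug-< C _ _ (redexEnv-strict E s hρ) λ θ hθ eq → copy-< E s hρ (wkC C) hθ eq

⊸hRoot-≻ : {t t' : Tm Γ τ} → ⊸hRoot t t' → t ≻ t'
⊸hRoot-≻ (linh E H s) = redex-≻ E _ _ s λ ρ hρ →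
  plugH-< H _ _ (redexEnv-strict E s hρ) λ θ hθ eq → copy-< E s hρ (wkH H) hθ eq

-- The contractum loses at least the bonus toℕ ⟦s⟧ + 1 of the λ.
contraction-≻ : (E : ECx Γ Δ) (t : Tm (A ∷ Δ) τ) (s : Tm Γ A) (u : Tm Δ τ) →
                ((ρ : Env Γ) → StrictEnv ρ → Le τ (eval u (holeEnv E ρ)) (eval t (redexEnv E s ρ))) →
                app (plugE E (lam t)) s ≻ plugE E u
contraction-≻ {A = A} {τ = τ} E t s u u≤t = mk≻ λ ρ hρ →
  Le-Lt-trans τ (eval-plugE-≤ E u hρ)
    (Lt-Le-trans τ (plus-mono-<-≤ τ (Le⇒Lt-plus-suc τ (toℕ A (eval s ρ)) (u≤t ρ hρ)) ≤-refl)
                   (eval-plugE-≥ E (lam t) hρ (eval s ρ) (eval-strict s hρ)))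

βRoot-≻ : {t t' : Tm Γ τ} → βRoot t t' → t ≻ t'
βRoot-≻ (β {A = A} t s) = contraction-≻ holeE t s (t [ s ]) λ ρ hρ →
  eval-[]-≤ t s hρ (plus-strict A 1 (eval-strict s hρ)) (Le-plus-1 A (eval s ρ))

βdRoot-≻ : {t t' : Tm Γ τ} → βdRoot t t' → t ≻ t'
βdRoot-≻ (βd {A = A} E t s) = contraction-≻ E t s _ λ ρ hρ →
  let hρE = holeEnv-strict E hρ in
  eval-[]-≤ t (rename (wkE E) s) hρE (plus-strict A 1 (eval-strict s hρ))
    (Le-trans A (eval-rename-≤ s (wkE E) hρE hρ (≗ᴱ⇒≤ᴱ (holeEnv-wkE E ρ)))
                (Le-plus-1 A (eval s ρ)))

gRoot-≻ : {t t' : Tm Γ τ} → gRoot t t' → t ≻ t'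
gRoot-≻ (gc E t s) = contraction-≻ E (rename S t) s t λ ρ hρ →
  eval-rename-≥ t S (redexEnv-strict E s hρ) (holeEnv-strict E hρ) (≤ᴱ-refl (holeEnv E ρ))

→h-≻ : {t t' : Tm Γ τ} → t →h t' → t ≻ t'
→h-≻ (head L As t s) = plugL-≻ L (plugA-≻ As (βRoot-≻ (β t s)))

→a-≻ : {t t' : Tm Γ τ} → t →a t' → t ≻ t'
→a-≻ (a-lin p) = Comp-≻ ⊸Root-≻ p
→a-≻ (a-g p)   = Comp-≻ gRoot-≻ p

no-descent-ℕ : (f : ℕ → ℕ) → ¬ InfiniteDescendingSequence _<_ f
no-descent-ℕ f desc = descent∧wf⇒empty step <-wellFounded (f 0) (f , refl , desc)
  where
  step : Descent _<_ (λ n → ∃[ g ] InfiniteDescendingSequenceFrom _<_ g n)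
  step (g , refl , g↓) = g 1 , g↓ 0 , g ∘ suc , refl , g↓ ∘ suc

SN-by-measure : {R : Rel} (μ : Tm Γ τ → ℕ) → (∀ {t u} → R t u → μ u < μ t) →
                (t : Tm Γ τ) → SN R t
SN-by-measure μ μ↓ t (f , _ , steps) = no-descent-ℕ (μ ∘ f) (μ↓ ∘ steps)

size : Tm Γ τ → ℕ
size {τ = τ} t = toℕ τ (eval t (λ {A} _ → fromℕ A 0))

≻⇒size-< : {t t' : Tm Γ τ} → t ≻ t' → size t' < size t
≻⇒size-< {τ = τ} d = toℕ-mono-< τ (decreases d _ (λ {A} _ → fromℕ-strict A 0))

≻⇒SN : {R : Rel} → (∀ {Γ τ} {t u : Tm Γ τ} → R t u → t ≻ u) → (t : Tm Γ τ) → SN R t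
≻⇒SN {R = R} R⊆≻ = SN-by-measure {R = R} size (λ r → ≻⇒size-< (R⊆≻ r))

theorem20 : ∀ {Γ τ} (t : Tm Γ τ) →
    SN _→a_ t × SN _⊸_ t × SN _→βd_ t × SN _→β_ t × SN _→h_ t × SN _⊸h_ t
theorem20 t =
  ≻⇒SN →a-≻ t ,
  ≻⇒SN (Comp-≻ ⊸Root-≻) t ,
  ≻⇒SN (Comp-≻ βdRoot-≻) t ,
  ≻⇒SN (Comp-≻ βRoot-≻) t ,
  ≻⇒SN →h-≻ t ,
  ≻⇒SN (HComp-≻ ⊸hRoot-≻) t
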